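{- Let $t,s$ be reduced trees different from $|$. Let $k$ be the number of internal vertices on the path from the root of $t$ to its right-most leaf and $l$ the number of internal vertices on the path from the root of $s$ to its left-most leaf, and let $F_1,\dots,F_k$ (forests of $t$ in its right comb representation) and $F_{k+1},\dots,F_{k+l}$ (forests of $s$ in its left comb representation) be as in the context. Then $$t*s=\sum_{\sigma\in\mathrm{QSh}(k,l)}\sigma(t,s).$$
   Context: A reduced tree is a planar rooted tree whose internal vertices all have at least two children; $|$ is the tree with one leaf and no internal vertex. $T_n$ = reduced trees with $n+1$ leaves, $\mathcal{A}=\bigoplus_{n\ge0}\mathbb{K}T_n$, $\mathcal{A}^+=\bigoplus_{n\ge1}\mathbb{K}T_n$. $x^{(0)}\vee\cdots\vee x^{(k)}$ ($k\ge1$) grafts trees left to right on a new root (multilinear). Recursively, for $x=x^{(0)}\vee\cdots\vee x^{(k)}$, $y=y^{(0)}\vee\cdots\vee y^{(l)}$: $x\prec y=x^{(0)}\vee\cdots\vee x^{(k-1)}\vee(x^{(k)}*y)$, $x\cdot y=x^{(0)}\vee\cdots\vee x^{(k-1)}\vee(x^{(k)}*y^{(0)})\vee y^{(1)}\vee\cdots\vee y^{(l)}$, $x\succ y=(x*y^{(0)})\vee y^{(1)}\vee\cdots\vee y^{(l)}$, where $*=\prec+\cdot+\succ$ and $|$ is a unit for $*$ (this is the free tridendriform algebra on one generator). Right comb of $t\neq|$: let $v_1$ (the root),\dots,$v_k$ be the internal vertices on the path from the root to the right-most leaf; $F_i$ is the (nonempty) ordered forest of subtrees rooted at the children of $v_i$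 other than its last child (a child that is a leaf contributes $|$). Left comb of $s\neq|$: let $w_1$ (root),\dots,$w_l$ be the internal vertices on the path to the left-most leaf; $F_{k+j}$ is the ordered forest of subtrees rooted at the children of $w_j$ other than its first child. A $(k,l)$-quasi-shuffle ($k,l\ge1$) is a surjection $\sigma:\{1,\dots,k+l\}\to\{1,\dots,n\}$ (some $n$) with $\sigma(1)<\cdots<\sigma(k)$ and $\sigma(k+1)<\cdots<\sigma(k+l)$; $\mathrm{QSh}(k,l)$ is their set. For such $\sigma$, $\sigma(t,s)$ is the tree obtained from a ladder of $n$ internal vertices $u_1$ (root),\dots,$u_n$ ($u_{r+1}$ a child of $u_r$, $u_n$ having a leaf as ladder continuation) by grafting, for each $i\le k$, the forest $F_i$ as children of $u_{\sigma(i)}$ to the left of the ladder continuation, and for each $i\in\{k+1,\dots,k+l\}$, the forest $F_i$ as children of $u_{\sigma(i)}$ to the right of the ladder continuation. -}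

module Defs where

open import Data.Nat using (ℕ; zero; suc; _+_)
open import Data.Fin as Fin using (Fin; zero; suc; _↑ˡ_; _↑ʳ_; splitAt)
open import Data.Fin.Properties using () renaming (_≟_ to _≟F_)
open import Data.List using (List; []; _∷_; _++_; [_]; map; concatMap; concat; filter; length; lookup; allFin)
open import Data.List.Relation.Unary.Any using (Any)
open import Data.List.Relation.Unary.AllPairs using (AllPairs)
open import Data.Product using (Σ; ∃; _×_; _,_)
open import Data.Sum using (inj₁; inj₂)
open import Relation.Binary.PropositionalEquality using (_≡_)
open import Relation.Nullary using (¬_)

-- Reduced planar rooted trees.
-- `leaf` is the tree | .  `node a m b` is the tree whose root has the
-- ordered list of children  a ∷ m ++ [ b ]  (so at least two children);
-- i.e. node a m b = a ∨ m₁ ∨ … ∨ b.  This is a bijective encoding of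
-- reduced planar trees.

data Tree : Set where
  leaf : Tree
  node : Tree → List Tree → Tree → Tree

-- Elements of ⊕ ℕ T_n (linear combinations with ℕ coefficients) are
-- represented as lists of trees, considered up to permutation (_↭_).
-- Addition is _++_.

-- The tridendriform product  * = ≺ + · + ≻  with | as unit.
-- For x = node a m b  (x⁽⁰⁾ = a, …, x⁽ᵏ⁾ = b) and y = node c n d
-- (y⁽⁰⁾ = c, y⁽¹⁾ … y⁽ˡ⁾ = n ++ [ d ]):
--   x ≺ y = x⁽⁰⁾ ∨ … ∨ x⁽ᵏ⁻¹⁾ ∨ (x⁽ᵏ⁾ * y)                 = node a m (b * y)
--   x · y = x⁽⁰⁾ ∨ … ∨ x⁽ᵏ⁻¹⁾ ∨ (x⁽ᵏ⁾ * y⁽⁰⁾) ∨ y⁽¹⁾ ∨ … ∨ y⁽ˡ⁾ = node a (m ++ (b * c) ∷ n) d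
--   x ≻ y = (x * y⁽⁰⁾) ∨ y⁽¹⁾ ∨ … ∨ y⁽ˡ⁾                      = node (x * c) n d
-- (extended multilinearly in the slot holding a linear combination).

infixl 7 _*_
_*_ : Tree → Tree → List Tree
leaf * y = [ y ]
node a m b * leaf = [ node a m b ]
node a m b * node c n d =
     map (λ z → node a m z) (b * node c n d)
  ++ map (λ z → node a (m ++ z ∷ n) d) (b * c)
  ++ map (λ z → node z n d) (node a m b * c)

-- Grafting an ordered forest (list of trees) on a new root.
-- Only used on lists of length ≥ 2 (for shorter lists the value is an
-- irrelevant default).

splitLast : Tree → List Tree → List Tree × Tree
splitLast x [] = [] , x
splitLast x (y ∷ ys) with splitLast y ys
... | (m , l) = (x ∷ m) , l

graft : List Tree → Tree
graft [] = leaf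
graft (x ∷ []) = x
graft (a ∷ b ∷ rest) with splitLast b rest
... | (m , l) = node a m l

-- Right comb of t: list [F₁, …, F_k], F_i = children of v_i except the last.
rightComb : Tree → List (List Tree)
rightComb leaf = []
rightComb (node a m b) = (a ∷ m) ∷ rightComb b

-- Left comb of s: list [G₁, …, G_l], G_j = children of w_j except the first.
leftComb : Tree → List (List Tree)
leftComb leaf = []
leftComb (node c n d) = (n ++ [ d ]) ∷ leftComb c

-- (k,l)-quasi-shuffles: surjections σ : {1..k+l} → {1..n} increasing on
-- {1..k} and on {k+1..k+l}.  (Fin indices are 0-based.)

record QSh (k l : ℕ) : Set where
  field
    n    : ℕ
    σ    : Fin (k + l) → Fin n
    surj : ∀ (y : Fin n) → ∃ λ i → σ i ≡ y
    incˡ : ∀ (i j : Fin k) → i Fin.< j → σ (i ↑ˡ l) Fin.< σ (j ↑ˡ l)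
    incʳ : ∀ (i j : Fin l) → i Fin.< j → σ (k ↑ʳ i) Fin.< σ (k ↑ʳ j)

_≈Q_ : ∀ {k l} → QSh k l → QSh k l → Set
_≈Q_ {k} {l} p q = Σ (QSh.n p ≡ QSh.n q) λ _ →
  ∀ (i : Fin (k + l)) → Fin.toℕ (QSh.σ p i) ≡ Fin.toℕ (QSh.σ q i)

-- The ladder u₁ (root), …, u_n; the node u_r gets children
--   (left forests) ++ [ continuation ] ++ (right forests).
ladder : (m : ℕ) → (Fin m → List Tree) → (Fin m → List Tree) → Tree
ladder zero L R = leaf
ladder (suc m) L R = graft (L zero ++ ladder m (λ r → L (suc r)) (λ r → R (suc r)) ∷ R zero)

σTree : ∀ {k l} → (Fin (k + l) → List Tree) → QSh k l → Tree
σTree {k} {l} F q = ladder n Lf Rf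
  where
    open QSh q
    Lf : Fin n → List Tree
    Lf r = concatMap (λ i → F (i ↑ˡ l)) (filter (λ i → σ (i ↑ˡ l) ≟F r) (allFin k))
    Rf : Fin n → List Tree
    Rf r = concatMap (λ j → F (k ↑ʳ j)) (filter (λ j → σ (k ↑ʳ j) ≟F r) (allFin l))

combForests : (t s : Tree) → Fin (length (rightComb t) + length (leftComb s)) → List Tree
combForests t s i with splitAt (length (rightComb t)) i
... | inj₁ a = lookup (rightComb t) a
... | inj₂ b = lookup (leftComb s) b

qshTree : (t s : Tree) → QSh (length (rightComb t)) (length (leftComb s)) → Tree
qshTree t s q = σTree (combForests t s) q

IsEnumeration : ∀ {k l} → List (QSh k l) → Set
IsEnumeration qs = (∀ q → Any (_≈Q_ q) qs) × AllPairs (λ p q → ¬ (p ≈Q q)) qs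

-- A (k,l)-quasi-shuffle is the same thing as a word in three letters: reading the ladder
-- from the root, each vertex u_r receives a forest of t only, of s only, or one of each.
-- Sorting words by their first letter gives exactly the three-term recursion
-- x * y = x ≺ y + x · y + x ≻ y, with the first letter grafting the forest F₁ of t,
-- both F₁ and F_{k+1}, or the forest F_{k+1} of s at the root. Conversely a word is recovered
-- from σ by peeling off the bottom level of its two strictly increasing, jointly surjective
-- restrictions to {1..k} and {k+1..k+l}.
module Submission where

open import Defs
open import Data.Bool using (true; false; if_then_else_)
open import Data.Empty using (⊥-elim)
open import Data.Fin as Fin using (Fin; zero; suc; _↑ˡ_; _↑ʳ_; splitAt; toℕ; punchOut)
open import Data.Fin.Properties using (_≟_; 0≢1+n; suc-injective; punchIn-punchOut; splitAt-↑ˡ; splitAt-↑ʳ; join-splitAt; toℕ-injective)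
open import Data.List using (List; []; _∷_; _++_; [_]; map; concat; concatMap; filter; tabulate; allFin; lookup; length)
open import Data.List.Properties using (map-++; map-∘; map-cong; map-tabulate; ++-identityʳ; ++-assoc; tabulate-cong)
open import Data.List.Membership.Propositional using (_∈_)
open import Data.List.Membership.Propositional.Properties using (∈-map⁺; ∈-map⁻; ∈-++⁺ˡ; ∈-++⁺ʳ; ∈-++⁻)
open import Data.List.Relation.Binary.Disjoint.Propositional using (Disjoint)
open import Data.List.Relation.Binary.Permutation.Propositional using (_↭_; ↭-reflexive; ↭-trans)
open import Data.List.Relation.Binary.Permutation.Propositional.Properties as ↭ using ()
open import Data.List.Relation.Unary.All as All using ()
open import Data.List.Relation.Unary.AllPairs as AllPairs using ()
import Data.List.Relation.Unary.AllPairs.Properties as AllPairs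
open import Data.List.Relation.Unary.Any as Any using (Any)
import Data.List.Relation.Unary.Any.Properties as Any
open import Data.List.Relation.Unary.Unique.Propositional using (Unique)
import Data.List.Relation.Unary.Unique.Propositional.Properties as Unique
open import Data.Nat as ℕ using (ℕ; zero; suc; s≤s; z≤n; s<s⁻¹)
open import Data.Nat.Properties using (n≮0)
open import Data.Product as Product using (Σ; ∃; _×_; _,_)
open import Data.Sum as Sum using (_⊎_; inj₁; inj₂; [_,_]′)
open import Data.Sum.Properties using ([,]-∘)
open import Data.Vec.Functional using () renaming (_∷_ to _◂_; _++_ to _⊕_)
open import Data.Vec.Functional.Properties using (lookup-++ˡ; lookup-++ʳ; ++-injectiveˡ; ++-injectiveʳ) renaming (++-cong to ⊕-cong)
open import Function using (_∘_; id)
open import Relation.Binary.Core using (_Preserves_⟶_)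
open import Relation.Binary.PropositionalEquality hiding ([_])
open import Relation.Nullary using (does; yes; no)
open import Relation.Unary using (Decidable)

private
  variable
    A B C D : Set
    k l n k′ l′ : ℕ

-- Strictly increasing maps between finite ordinals

StrictlyIncreasing : (Fin k → Fin n) → Set
StrictlyIncreasing h = h Preserves Fin._<_ ⟶ Fin._<_

JointlySurjective : (Fin k → Fin n) → (Fin l → Fin n) → Set
JointlySurjective {n = n} f g = (y : Fin n) → (∃ λ i → f i ≡ y) ⊎ (∃ λ j → g j ≡ y)

suc∘-increasing : {h : Fin k → Fin n} → StrictlyIncreasing h → StrictlyIncreasing (suc ∘ h)
suc∘-increasing h< i<j = s≤s (h< i<j)

zero◂suc∘-increasing : {h : Fin k → Fin n} → StrictlyIncreasing h →
                       StrictlyIncreasing (zero ◂ suc ∘ h)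
zero◂suc∘-increasing h< {zero}  {suc j} _         = s≤s z≤n
zero◂suc∘-increasing h< {suc i} {suc j} (s≤s i<j) = s≤s (h< i<j)

increasing-≗ : {h h′ : Fin k → Fin n} → h ≗ h′ → StrictlyIncreasing h′ → StrictlyIncreasing h
increasing-≗ eq h′< {i} {j} i<j = subst₂ Fin._<_ (sym (eq i)) (sym (eq j)) (h′< i<j)

increasing-suc⁻¹ : {h : Fin k → Fin (suc n)} {h′ : Fin k → Fin n} →
                   suc ∘ h′ ≗ h → StrictlyIncreasing h → StrictlyIncreasing h′
increasing-suc⁻¹ eq h< i<j = s<s⁻¹ (increasing-≗ eq h< i<j)

increasing-suc≢zero : {h : Fin (suc k) → Fin (suc n)} → StrictlyIncreasing h → ∀ i → h (suc i) ≢ zero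
increasing-suc≢zero {h = h} h< i eq = n≮0 (subst (h zero Fin.<_) eq (h< (s≤s z≤n)))

data Peel {n : ℕ} : {k : ℕ} → (Fin k → Fin (suc n)) → Set where
  hit  : {h : Fin (suc k) → Fin (suc n)} (h′ : Fin k → Fin n) →
         StrictlyIncreasing h′ → h ≗ zero ◂ suc ∘ h′ → Peel h
  miss : {h : Fin k → Fin (suc n)} (h′ : Fin k → Fin n) →
         StrictlyIncreasing h′ → h ≗ suc ∘ h′ → Peel h

lower : (h : Fin k → Fin (suc n)) → (∀ i → zero ≢ h i) → Fin k → Fin n
lower h h≢0 i = punchOut (h≢0 i)

suc∘lower : (h : Fin k → Fin (suc n)) (h≢0 : ∀ i → zero ≢ h i) → suc ∘ lower h h≢0 ≗ h
suc∘lower h h≢0 i = punchIn-punchOut (h≢0 i)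

peel : (h : Fin k → Fin (suc n)) → StrictlyIncreasing h → Peel h
peel {zero} h h< = miss (lower h λ ()) (increasing-suc⁻¹ (suc∘lower h λ ()) h<) λ ()
peel {suc k} h h< with h zero ≟ zero
... | yes h0≡0 = hit (lower (h ∘ suc) h∘suc≢0)
                     (increasing-suc⁻¹ (suc∘lower (h ∘ suc) h∘suc≢0) (λ i<j → h< (s≤s i<j))) eq
  where
  h∘suc≢0 : ∀ i → zero ≢ h (suc i)
  h∘suc≢0 i = increasing-suc≢zero h< i ∘ sym
  eq : h ≗ zero ◂ suc ∘ lower (h ∘ suc) h∘suc≢0
  eq zero    = h0≡0
  eq (suc i) = sym (suc∘lower (h ∘ suc) h∘suc≢0 i)
... | no h0≢0 = miss (lower h h≢0) (increasing-suc⁻¹ (suc∘lower h h≢0) h<) (sym ∘ suc∘lower h h≢0)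
  where
  h≢0 : ∀ i → zero ≢ h i
  h≢0 zero    = h0≢0 ∘ sym
  h≢0 (suc i) = increasing-suc≢zero h< i ∘ sym

hit-preimage : {h : Fin (suc k) → Fin (suc n)} {h′ : Fin k → Fin n} → h ≗ zero ◂ suc ∘ h′ →
               ∀ {i y} → h i ≡ suc y → ∃ λ i′ → h′ i′ ≡ y
hit-preimage eq {zero}  e = ⊥-elim (0≢1+n (trans (sym (eq zero)) e))
hit-preimage eq {suc i} e = i , suc-injective (trans (sym (eq (suc i))) e)

miss-preimage : {h : Fin k → Fin (suc n)} {h′ : Fin k → Fin n} → h ≗ suc ∘ h′ →
                ∀ {i y} → h i ≡ suc y → ∃ λ i′ → h′ i′ ≡ y
miss-preimage eq {i} e = i , suc-injective (trans (sym (eq i)) e)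

miss-≢zero : {h : Fin k → Fin (suc n)} {h′ : Fin k → Fin n} → h ≗ suc ∘ h′ → ∀ {i} → h i ≢ zero
miss-≢zero eq {i} e = 0≢1+n (trans (sym e) (eq i))

hit-≗ : {h : Fin (suc k) → Fin (suc n)} {h′ u : Fin k → Fin n} →
        h ≗ zero ◂ suc ∘ h′ → h′ ≗ u → h ≗ zero ◂ suc ∘ u
hit-≗ eq e zero    = eq zero
hit-≗ eq e (suc i) = trans (eq (suc i)) (cong suc (e i))

miss-≗ : {h : Fin k → Fin (suc n)} {h′ u : Fin k → Fin n} → h ≗ suc ∘ h′ → h′ ≗ u → h ≗ suc ∘ u
miss-≗ eq e i = trans (eq i) (cong suc (e i))

jointlySurjective-suc⁻¹ : {f : Fin k → Fin (suc n)} {g : Fin l → Fin (suc n)}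
                          {f′ : Fin k′ → Fin n} {g′ : Fin l′ → Fin n} → JointlySurjective f g →
                          (∀ {i y} → f i ≡ suc y → ∃ λ i′ → f′ i′ ≡ y) →
                          (∀ {j y} → g j ≡ suc y → ∃ λ j′ → g′ j′ ≡ y) →
                          JointlySurjective f′ g′
jointlySurjective-suc⁻¹ fg f↓ g↓ y = Sum.map (λ (_ , e) → f↓ e) (λ (_ , e) → g↓ e) (fg (suc y))

-- Quasi-shuffles as words

data QShWord : ℕ → ℕ → ℕ → Set where
  []    : QShWord 0 0 0
  left  : QShWord k l n → QShWord (suc k) l (suc n)
  both  : QShWord k l n → QShWord (suc k) (suc l) (suc n)
  right : QShWord k l n → QShWord k (suc l) (suc n)

leftMap : QShWord k l n → Fin k → Fin n
leftMap []        = λ ()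
leftMap (left w)  = zero ◂ suc ∘ leftMap w
leftMap (both w)  = zero ◂ suc ∘ leftMap w
leftMap (right w) = suc ∘ leftMap w

rightMap : QShWord k l n → Fin l → Fin n
rightMap []        = λ ()
rightMap (left w)  = suc ∘ rightMap w
rightMap (both w)  = zero ◂ suc ∘ rightMap w
rightMap (right w) = zero ◂ suc ∘ rightMap w

leftMap-increasing : (w : QShWord k l n) → StrictlyIncreasing (leftMap w)
leftMap-increasing []        {()}
leftMap-increasing (left w)  = zero◂suc∘-increasing (leftMap-increasing w)
leftMap-increasing (both w)  = zero◂suc∘-increasing (leftMap-increasing w)
leftMap-increasing (right w) = suc∘-increasing (leftMap-increasing w)

rightMap-increasing : (w : QShWord k l n) → StrictlyIncreasing (rightMap w)
rightMap-increasing []        {()}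
rightMap-increasing (left w)  = suc∘-increasing (rightMap-increasing w)
rightMap-increasing (both w)  = zero◂suc∘-increasing (rightMap-increasing w)
rightMap-increasing (right w) = zero◂suc∘-increasing (rightMap-increasing w)

maps-jointlySurjective : (w : QShWord k l n) → JointlySurjective (leftMap w) (rightMap w)
maps-jointlySurjective (left w)  zero    = inj₁ (zero , refl)
maps-jointlySurjective (both w)  zero    = inj₁ (zero , refl)
maps-jointlySurjective (right w) zero    = inj₂ (zero , refl)
maps-jointlySurjective (left w)  (suc y) =
  Sum.map (Product.map suc (cong suc)) (Product.map id (cong suc)) (maps-jointlySurjective w y)
maps-jointlySurjective (both w)  (suc y) =
  Sum.map (Product.map suc (cong suc)) (Product.map suc (cong suc)) (maps-jointlySurjective w y)
maps-jointlySurjective (right w) (suc y) =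
  Sum.map (Product.map id (cong suc)) (Product.map suc (cong suc)) (maps-jointlySurjective w y)

maps-injective : (w w′ : QShWord k l n) → leftMap w ≗ leftMap w′ → rightMap w ≗ rightMap w′ → w ≡ w′
maps-injective []        []         _ _ = refl
maps-injective (left w)  (left w′)  p q =
  cong left (maps-injective w w′ (suc-injective ∘ p ∘ suc) (suc-injective ∘ q))
maps-injective (both w)  (both w′)  p q =
  cong both (maps-injective w w′ (suc-injective ∘ p ∘ suc) (suc-injective ∘ q ∘ suc))
maps-injective (right w) (right w′) p q =
  cong right (maps-injective w w′ (suc-injective ∘ p) (suc-injective ∘ q ∘ suc))
maps-injective (left _)  (both _)   _ q = ⊥-elim (0≢1+n (sym (q zero)))
maps-injective (left _)  (right _)  p _ = ⊥-elim (0≢1+n (p zero))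
maps-injective (both _)  (left _)   _ q = ⊥-elim (0≢1+n (q zero))
maps-injective (both _)  (right _)  p _ = ⊥-elim (0≢1+n (p zero))
maps-injective (right _) (left _)   p _ = ⊥-elim (0≢1+n (sym (p zero)))
maps-injective (right _) (both _)   p _ = ⊥-elim (0≢1+n (sym (p zero)))

fromMaps : (f : Fin k → Fin n) (g : Fin l → Fin n) → StrictlyIncreasing f → StrictlyIncreasing g →
         JointlySurjective f g → Σ (QShWord k l n) λ w → f ≗ leftMap w × g ≗ rightMap w
fromMaps {k = zero}  {zero} {l = zero}  f g _ _ _ = [] , (λ ()) , (λ ())
fromMaps {k = suc k} {zero}              f g _ _ _ with () ← f zero
fromMaps {k = zero}  {zero} {l = suc l}  f g _ _ _ with () ← g zero
fromMaps {n = suc n} f g f< g< fg with peel f f< | peel g g<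
... | hit f′ f′< f≗ | hit g′ g′< g≗ =
  let w , f′≗ , g′≗ = fromMaps f′ g′ f′< g′< (jointlySurjective-suc⁻¹ fg (hit-preimage f≗) (hit-preimage g≗))
  in both w , hit-≗ f≗ f′≗ , hit-≗ g≗ g′≗
... | hit f′ f′< f≗ | miss g′ g′< g≗ =
  let w , f′≗ , g′≗ = fromMaps f′ g′ f′< g′< (jointlySurjective-suc⁻¹ fg (hit-preimage f≗) (miss-preimage g≗))
  in left w , hit-≗ f≗ f′≗ , miss-≗ g≗ g′≗
... | miss f′ f′< f≗ | hit g′ g′< g≗ =
  let w , f′≗ , g′≗ = fromMaps f′ g′ f′< g′< (jointlySurjective-suc⁻¹ fg (miss-preimage f≗) (hit-preimage g≗))
  in right w , miss-≗ f≗ f′≗ , hit-≗ g≗ g′≗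
... | miss _ _ f≗ | miss _ _ g≗ =
  ⊥-elim ([ (λ (_ , e) → miss-≢zero f≗ e) , (λ (_ , e) → miss-≢zero g≗ e) ]′ (fg zero))

⊕-surjective : {f : Fin k → Fin n} {g : Fin l → Fin n} →
               JointlySurjective f g → ∀ y → ∃ λ i → (f ⊕ g) i ≡ y
⊕-surjective {f = f} {g} fg y =
  [ (λ (i , e) → i ↑ˡ _ , trans (lookup-++ˡ f g i) e) , (λ (j , e) → _ ↑ʳ j , trans (lookup-++ʳ f g j) e) ]′ (fg y)

⊕-split : (h : Fin (k ℕ.+ l) → A) → h ≗ (λ i → h (i ↑ˡ l)) ⊕ (λ j → h (k ↑ʳ j))
⊕-split {k} {l} h i = trans (cong h (sym (join-splitAt k l i))) ([,]-∘ h (splitAt k i))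

[,]-preimage : {f : Fin k → Fin n} {g : Fin l → Fin n} {y : Fin n} (x : Fin k ⊎ Fin l) →
               [ f , g ]′ x ≡ y → (∃ λ i → f i ≡ y) ⊎ (∃ λ j → g j ≡ y)
[,]-preimage (inj₁ i) e = inj₁ (i , e)
[,]-preimage (inj₂ j) e = inj₂ (j , e)

surjective⇒jointlySurjective : (h : Fin (k ℕ.+ l) → Fin n) → (∀ y → ∃ λ i → h i ≡ y) →
                               JointlySurjective (λ i → h (i ↑ˡ l)) (λ j → h (k ↑ʳ j))
surjective⇒jointlySurjective {k} h surj y =
  let i , e = surj y in [,]-preimage (splitAt k i) (trans (sym (⊕-split {k} h i)) e)

toQSh : ∃ (QShWord k l) → QSh k l
toQSh (n , w) = record
  { n    = n
  ; σ    = leftMap w ⊕ rightMap w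
  ; surj = ⊕-surjective (maps-jointlySurjective w)
  ; incˡ = λ _ _ → increasing-≗ (lookup-++ˡ (leftMap w) (rightMap w)) (leftMap-increasing w)
  ; incʳ = λ _ _ → increasing-≗ (lookup-++ʳ (leftMap w) (rightMap w)) (rightMap-increasing w)
  }

toQSh-surjective : (q : QSh k l) → Σ (∃ (QShWord k l)) λ p → q ≈Q toQSh p
toQSh-surjective {k} {l} q =
  let w , f≗ , g≗ = fromMaps (λ i → σ (i ↑ˡ l)) (λ j → σ (k ↑ʳ j))
                             (λ {i} {j} → incˡ i j) (λ {i} {j} → incʳ i j)
                             (surjective⇒jointlySurjective σ surj)
  in (QSh.n q , w) , refl , λ i → cong toℕ (trans (⊕-split {k} σ i) (⊕-cong _ _ f≗ g≗ i))
  where open QSh q using (σ; surj; incˡ; incʳ)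

toQSh-injective : {p p′ : ∃ (QShWord k l)} → toQSh p ≈Q toQSh p′ → p ≡ p′
toQSh-injective {p = n , w} {_ , w′} (refl , eq) =
  cong (n ,_) (maps-injective w w′ (++-injectiveˡ _ _ σ≗) (++-injectiveʳ _ _ σ≗))
  where
  σ≗ : leftMap w ⊕ rightMap w ≗ leftMap w′ ⊕ rightMap w′
  σ≗ i = toℕ-injective (eq i)

left∃ : ∃ (QShWord k l) → ∃ (QShWord (suc k) l)
left∃ (n , w) = suc n , left w

both∃ : ∃ (QShWord k l) → ∃ (QShWord (suc k) (suc l))
both∃ (n , w) = suc n , both w

right∃ : ∃ (QShWord k l) → ∃ (QShWord k (suc l))
right∃ (n , w) = suc n , right w

words : ∀ k l → List (∃ (QShWord k l))
words zero    zero    = [ 0 , [] ]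
words (suc k) zero    = map left∃ (words k zero)
words zero    (suc l) = map right∃ (words zero l)
words (suc k) (suc l) = map left∃ (words k (suc l))
                     ++ map both∃ (words k l)
                     ++ map right∃ (words (suc k) l)

∈-words : (w : QShWord k l n) → (n , w) ∈ words k l
∈-words []                           = Any.here refl
∈-words {l = zero}  (left w)         = ∈-map⁺ _ (∈-words w)
∈-words {l = suc l} (left w)         = ∈-++⁺ˡ (∈-map⁺ _ (∈-words w))
∈-words {k = suc k} {l = suc l} (both w) = ∈-++⁺ʳ (map _ (words k (suc l))) (∈-++⁺ˡ (∈-map⁺ _ (∈-words w)))
∈-words {k = zero}  (right w)        = ∈-map⁺ _ (∈-words w)
∈-words {k = suc k} {l = suc l} (right w) =
  ∈-++⁺ʳ (map _ (words k (suc l))) (∈-++⁺ʳ (map _ (words k l)) (∈-map⁺ _ (∈-words w)))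

map-disjoint : {f : A → C} {g : B → C} → (∀ x y → f x ≢ g y) → ∀ {xs ys} → Disjoint (map f xs) (map g ys)
map-disjoint {f = f} {g} f≢g (v∈fxs , v∈gys) with ∈-map⁻ f v∈fxs | ∈-map⁻ g v∈gys
... | x , _ , refl | y , _ , e = f≢g x y e

disjoint-++ : {xs ys zs : List A} → Disjoint xs ys → Disjoint xs zs → Disjoint xs (ys ++ zs)
disjoint-++ {ys = ys} d d′ (v∈xs , v∈ys++zs) =
  [ (λ v∈ys → d (v∈xs , v∈ys)) , (λ v∈zs → d′ (v∈xs , v∈zs)) ]′ (∈-++⁻ ys v∈ys++zs)

words-unique : ∀ k l → Unique (words k l)
words-unique zero    zero    = All.[] AllPairs.∷ AllPairs.[]
words-unique (suc k) zero    = Unique.map⁺ (λ { refl → refl }) (words-unique k zero)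
words-unique zero    (suc l) = Unique.map⁺ (λ { refl → refl }) (words-unique zero l)
words-unique (suc k) (suc l) =
  Unique.++⁺ (Unique.map⁺ (λ { refl → refl }) (words-unique k (suc l)))
    (Unique.++⁺ (Unique.map⁺ (λ { refl → refl }) (words-unique k l))
                (Unique.map⁺ (λ { refl → refl }) (words-unique (suc k) l))
                (map-disjoint λ _ _ ()))
    (disjoint-++ {ys = map both∃ (words k l)} (map-disjoint λ _ _ ()) (map-disjoint λ _ _ ()))

words-enumeration : ∀ k l → IsEnumeration (map toQSh (words k l))
words-enumeration k l =
  complete , AllPairs.map⁺ (AllPairs.map (λ p≢p′ → p≢p′ ∘ toQSh-injective) (words-unique k l))
  where
  complete : ∀ q → Any (q ≈Q_) (map toQSh (words k l))
  complete q = let (_ , w) , q≈w = toQSh-surjective q in Any.map⁺ (Any.map (λ { refl → q≈w }) (∈-words w))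

-- The trees σ(t,s)

-- Written with tabulate rather than filter (compare σTree) so that it computes on maps of the
-- form zero ◂ suc ∘ h and suc ∘ h, which makes ladders of words unfold definitionally.
fibre : (Fin k → Fin n) → (Fin k → List A) → Fin n → List A
fibre h F r = concat (tabulate λ i → if does (h i ≟ r) then F i else [])

concat-tabulate-[] : concat {A = A} (tabulate {n = k} λ _ → []) ≡ []
concat-tabulate-[] {k = zero}  = refl
concat-tabulate-[] {k = suc k} = concat-tabulate-[] {k = k}

concatMap-filter : {P : A → Set} (P? : Decidable P) (F : A → List B) (xs : List A) →
                   concatMap F (filter P? xs) ≡ concatMap (λ x → if does (P? x) then F x else []) xs
concatMap-filter P? F []       = refl
concatMap-filter P? F (x ∷ xs) with does (P? x)
... | true  = cong (F x ++_) (concatMap-filter P? F xs)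
... | false = concatMap-filter P? F xs

concatMap-filter-allFin : (h : Fin k → Fin n) (F : Fin k → List A) (r : Fin n) →
                          concatMap F (filter (λ i → h i ≟ r) (allFin k)) ≡ fibre h F r
concatMap-filter-allFin {k} h F r =
  trans (concatMap-filter (λ i → h i ≟ r) F (allFin k)) (cong concat (map-tabulate {n = k} id _))

fibre-cong : {h h′ : Fin k → Fin n} {F F′ : Fin k → List A} → h ≗ h′ → F ≗ F′ → fibre h F ≗ fibre h′ F′
fibre-cong eh eF r =
  cong concat (tabulate-cong λ i → cong₂ (λ x xs → if does (x ≟ r) then xs else []) (eh i) (eF i))

fibre-zero◂suc∘ : (h : Fin k → Fin n) (F : Fin (suc k) → List A) →
                  fibre (zero ◂ Fin.suc ∘ h) F zero ≡ F zero
fibre-zero◂suc∘ {k} h F = trans (cong (F zero ++_) (concat-tabulate-[] {k = k})) (++-identityʳ (F zero))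

fibre-suc∘ : (h : Fin k → Fin n) (F : Fin k → List A) → fibre (Fin.suc ∘ h) F zero ≡ []
fibre-suc∘ {k} h F = concat-tabulate-[] {k = k}

ladder-cong : ∀ n {L L′ R R′ : Fin n → List Tree} → L ≗ L′ → R ≗ R′ → ladder n L R ≡ ladder n L′ R′
ladder-cong zero    eL eR = refl
ladder-cong (suc n) eL eR =
  cong graft (cong₂ _++_ (eL zero) (cong₂ _∷_ (ladder-cong n (eL ∘ suc) (eR ∘ suc)) (eR zero)))

shuffleTree : QShWord k l n → (Fin k → List Tree) → (Fin l → List Tree) → Tree
shuffleTree {n = n} w FL FR = ladder n (fibre (leftMap w) FL) (fibre (rightMap w) FR)

shuffleTree-cong : (w : QShWord k l n) {FL FL′ : Fin k → List Tree} {FR FR′ : Fin l → List Tree} →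
                   FL ≗ FL′ → FR ≗ FR′ → shuffleTree w FL FR ≡ shuffleTree w FL′ FR′
shuffleTree-cong {n = n} w eL eR =
  ladder-cong n (fibre-cong {h = leftMap w} (λ _ → refl) eL) (fibre-cong {h = rightMap w} (λ _ → refl) eR)

shuffleTree-left : (w : QShWord k l n) → ∀ FL FR →
                   shuffleTree (left w) FL FR ≡ graft (FL zero ++ [ shuffleTree w (FL ∘ suc) FR ])
shuffleTree-left w FL FR = cong₂ (λ A B → graft (A ++ shuffleTree w (FL ∘ suc) FR ∷ B))
  (fibre-zero◂suc∘ (leftMap w) FL) (fibre-suc∘ (rightMap w) FR)

shuffleTree-both : (w : QShWord k l n) → ∀ FL FR →
                   shuffleTree (both w) FL FR ≡
                   graft (FL zero ++ shuffleTree w (FL ∘ suc) (FR ∘ suc) ∷ FR zero)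
shuffleTree-both w FL FR = cong₂ (λ A B → graft (A ++ shuffleTree w (FL ∘ suc) (FR ∘ suc) ∷ B))
  (fibre-zero◂suc∘ (leftMap w) FL) (fibre-zero◂suc∘ (rightMap w) FR)

shuffleTree-right : (w : QShWord k l n) → ∀ FL FR →
                    shuffleTree (right w) FL FR ≡ graft (shuffleTree w FL (FR ∘ suc) ∷ FR zero)
shuffleTree-right w FL FR = cong₂ (λ A B → graft (A ++ shuffleTree w FL (FR ∘ suc) ∷ B))
  (fibre-suc∘ (leftMap w) FL) (fibre-zero◂suc∘ (rightMap w) FR)

σTree-toQSh : (F : Fin (k ℕ.+ l) → List Tree) (w : QShWord k l n) →
              σTree F (toQSh (n , w)) ≡ shuffleTree w (λ i → F (i ↑ˡ l)) (λ j → F (k ↑ʳ j))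
σTree-toQSh {k} {l} {n} F w = ladder-cong n
  (λ r → trans (concatMap-filter-allFin (λ i → σ (i ↑ˡ l)) (λ i → F (i ↑ˡ l)) r)
               (fibre-cong (lookup-++ˡ (leftMap w) (rightMap w)) (λ _ → refl) r))
  (λ r → trans (concatMap-filter-allFin (λ j → σ (k ↑ʳ j)) (λ j → F (k ↑ʳ j)) r)
               (fibre-cong (lookup-++ʳ (leftMap w) (rightMap w)) (λ _ → refl) r))
  where σ = leftMap w ⊕ rightMap w

-- The product t * s

splitLast-snoc : ∀ x m y → splitLast x (m ++ [ y ]) ≡ (x ∷ m , y)
splitLast-snoc x []      y = refl
splitLast-snoc x (z ∷ m) y rewrite splitLast-snoc z m y = refl

graft-node : ∀ a m y → graft (a ∷ m ++ [ y ]) ≡ node a m y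
graft-node a []      y = refl
graft-node a (z ∷ m) y rewrite splitLast-snoc z m y = refl

graft-node-middle : ∀ a m x n d → graft ((a ∷ m) ++ x ∷ n ++ [ d ]) ≡ node a (m ++ x ∷ n) d
graft-node-middle a m x n d =
  trans (cong (λ ys → graft (a ∷ ys)) (sym (++-assoc m (x ∷ n) [ d ]))) (graft-node a (m ++ x ∷ n) d)

combTree : (t s : Tree) → ∃ (QShWord (length (rightComb t)) (length (leftComb s))) → Tree
combTree t s (_ , w) = shuffleTree w (lookup (rightComb t)) (lookup (leftComb s))

combTree-left : ∀ a m b s p → combTree (node a m b) s (left∃ p) ≡ node a m (combTree b s p)
combTree-left a m b s (_ , w) =
  trans (shuffleTree-left w (lookup (rightComb (node a m b))) (lookup (leftComb s))) (graft-node a m _)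

combTree-both : ∀ a m b c n d p →
                combTree (node a m b) (node c n d) (both∃ p) ≡ node a (m ++ combTree b c p ∷ n) d
combTree-both a m b c n d (_ , w) =
  trans (shuffleTree-both w (lookup (rightComb (node a m b))) (lookup (leftComb (node c n d))))
        (graft-node-middle a m _ n d)

combTree-right : ∀ t c n d p → combTree t (node c n d) (right∃ p) ≡ node (combTree t c p) n d
combTree-right t c n d (_ , w) =
  trans (shuffleTree-right w (lookup (rightComb t)) (lookup (leftComb (node c n d)))) (graft-node _ n d)

map-∘-square : {h : C → D} {c : A → C} {g : B → D} {f : A → B} →
               (∀ x → h (c x) ≡ g (f x)) → ∀ xs → map h (map c xs) ≡ map g (map f xs)
map-∘-square e xs = trans (sym (map-∘ xs)) (trans (map-cong e xs) (map-∘ xs))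

combTrees-leafˡ : ∀ s → map (combTree leaf s) (words 0 (length (leftComb s))) ≡ [ s ]
combTrees-leafˡ leaf         = refl
combTrees-leafˡ (node c n d) =
  trans (map-∘-square (combTree-right leaf c n d) _) (cong (map λ x → node x n d) (combTrees-leafˡ c))

combTrees-leafʳ : ∀ t → map (combTree t leaf) (words (length (rightComb t)) 0) ≡ [ t ]
combTrees-leafʳ leaf         = refl
combTrees-leafʳ (node a m b) =
  trans (map-∘-square (combTree-left a m b leaf) _) (cong (map (node a m)) (combTrees-leafʳ b))

*-combTrees : ∀ t s → t * s ↭ map (combTree t s) (words (length (rightComb t)) (length (leftComb s)))
*-combTrees leaf           s            = ↭-reflexive (sym (combTrees-leafˡ s))
*-combTrees t@(node _ _ _) leaf         = ↭-reflexive (sym (combTrees-leafʳ t))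
*-combTrees t@(node a m b) s@(node c n d) =
  ↭-trans (↭.++⁺ (map⁺-square (combTree-left a m b s) (*-combTrees b s))
                 (↭.++⁺ (map⁺-square (combTree-both a m b c n d) (*-combTrees b c))
                        (map⁺-square (combTree-right t c n d) (*-combTrees t c))))
          (↭-reflexive (sym (map-++³ (combTree t s) (map left∃ (words kb (suc lc))) (map both∃ (words kb lc))
                                                     (map right∃ (words (suc kb) lc)))))
  where
  kb = length (rightComb b)
  lc = length (leftComb c)
  map⁺-square : {h : C → D} {c : A → C} {g : B → D} {f : A → B} {xs : List A} {ys : List B} →
                (∀ x → h (c x) ≡ g (f x)) → ys ↭ map f xs → map g ys ↭ map h (map c xs)
  map⁺-square {g = g} e p = ↭-trans (↭.map⁺ g p) (↭-reflexive (sym (map-∘-square e _)))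
  map-++³ : (h : A → B) (xs ys zs : List A) → map h (xs ++ ys ++ zs) ≡ map h xs ++ map h ys ++ map h zs
  map-++³ h xs ys zs = trans (map-++ h xs _) (cong (map h xs ++_) (map-++ h ys zs))

combForests-↑ˡ : ∀ t s i → combForests t s (i ↑ˡ length (leftComb s)) ≡ lookup (rightComb t) i
combForests-↑ˡ t s i rewrite splitAt-↑ˡ (length (rightComb t)) i (length (leftComb s)) = refl

combForests-↑ʳ : ∀ t s j → combForests t s (length (rightComb t) ↑ʳ j) ≡ lookup (leftComb s) j
combForests-↑ʳ t s j rewrite splitAt-↑ʳ (length (rightComb t)) (length (leftComb s)) j = refl

qshTree-toQSh : ∀ t s p → qshTree t s (toQSh p) ≡ combTree t s p
qshTree-toQSh t s (_ , w) =
  trans (σTree-toQSh (combForests t s) w) (shuffleTree-cong w (combForests-↑ˡ t s) (combForests-↑ʳ t s))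

-- The identity also holds when t or s is |.
mainTheorem9 : (t s : Tree) → t ≢ leaf → s ≢ leaf →
    Σ (List (QSh (length (rightComb t)) (length (leftComb s)))) λ qs →
      IsEnumeration qs × (t * s ↭ map (qshTree t s) qs)
mainTheorem9 t s _ _ = map toQSh ws , words-enumeration _ _ ,
  ↭-trans (*-combTrees t s) (↭-reflexive (trans (map-cong (sym ∘ qshTree-toQSh t s) ws) (map-∘ ws)))
  where ws = words (length (rightComb t)) (length (leftComb s))
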